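{- Fix $D=N=\bot$ in Chu's translation. Let $B$ be a fully conservative $\mathcal{L}_b$-formula and $C$ a conservative $\mathcal{L}_b$-formula. Then there are $\mathbf{IMALL}$-proofs $\pi$ of $B^t\Leftrightarrow B$, $\sigma$ of $B^s\Leftrightarrow\bot$, and $\tau$ of $C^t\Leftrightarrow C$ with $l(\pi),l(\sigma)\le O(|B|)$ and $l(\tau)\le O(|C|)$. If $B$ and $C$ are $\mathcal{L}_!$-formulas (fully conservative, resp. conservative), the same holds with $\mathbf{IMALL}$ replaced by $\mathbf{ILL}$.
   Context: Formulas. $\mathcal{L}_b$-formulas are built from atoms and constants $0,1,\top,\bot$ by $\wedge,\vee,*,\to$; $\mathcal{L}_!$ adds unary $!$. $X\Leftrightarrow Y$ denotes the two sequents $X\Rightarrow Y$ and $Y\Rightarrow X$ (a proof of it means proofs of both). Calculi. $\mathbf{IMALL}$ is the single-conclusion calculus (at most one formula on the right) over $\mathcal{L}_b$ with axioms $A\Rightarrow A$, $\Rightarrow1$, $0\Rightarrow$, $\Gamma\Rightarrow\top$, $\Gamma,\bot\Rightarrow\Delta$ and rules: from $\Gamma\Rightarrow\Delta$ infer $\Gamma,1\Rightarrow\Delta$; from $\Gamma\Rightarrow$ infer $\Gamma\Rightarrow0$; from $\Gamma,A_i\Rightarrow\Delta$ infer $\Gamma,A_0\wedge A_1\Rightarrow\Delta$; from $\Gamma\Rightarrow A$ and $\Gamma\Rightarrow B$ infer $\Gamma\Rightarrow A\wedge B$; from $\Gamma,A\Rightarrow\Delta$ and $\Gamma,B\Rightarrow\Delta$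 infer $\Gamma,A\vee B\Rightarrow\Delta$; from $\Gamma\Rightarrow A_i$ infer $\Gamma\Rightarrow A_0\vee A_1$; from $\Gamma,A,B\Rightarrow\Delta$ infer $\Gamma,A*B\Rightarrow\Delta$; from $\Gamma\Rightarrow A$ and $\Sigma\Rightarrow B$ infer $\Gamma,\Sigma\Rightarrow A*B$; from $\Gamma\Rightarrow A$ and $\Sigma,B\Rightarrow\Lambda$ infer $\Gamma,\Sigma,A\to B\Rightarrow\Lambda$; from $\Gamma,A\Rightarrow B$ infer $\Gamma\Rightarrow A\to B$; cut: from $\Gamma\Rightarrow A$ and $\Sigma,A\Rightarrow\Lambda$ infer $\Gamma,\Sigma\Rightarrow\Lambda$. $\mathbf{ILL}$ (over $\mathcal{L}_!$) adds: from $!\Gamma\Rightarrow A$ infer $!\Gamma\Rightarrow!A$; from $\Gamma,A\Rightarrow\Delta$ infer $\Gamma,!A\Rightarrow\Delta$; from $\Gamma\Rightarrow\Delta$ infer $\Gamma,!A\Rightarrow\Delta$; from $\Gamma,!A,!A\Rightarrow\Delta$ infer $\Gamma,!A\Rightarrow\Delta$. $l(\pi)$ = total number of formula occurrences in the sequents of $\pi$; $|B|$ = number of symbols. Chu's translation with parameters $D,N$: $p^t=p$; $1^t=1$, $0^t=D$, $\top^t=\top$, $\bot^t=\bot$; $(A\circ B)^t=A^t\circ B^t$ for $\circ\in\{\wedge,\vee,*\}$; $(A\to B)^t=(A^t\to B^t)\wedge(B^s\to A^s)$; $(!A)^t=!A^t$; $p^s=N$; $1^s=D$, $0^s=1$,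 $\top^s=\bot$, $\bot^s=\top$; $(A\wedge B)^s=A^s\vee B^s$; $(A\vee B)^s=A^s\wedge B^s$; $(A*B)^s=(A^t\to B^s)\wedge(B^t\to A^s)$; $(A\to B)^s=A^t*B^s$; $(!A)^s=!A^t\to D$. Conservative formulas (defined over $\mathcal{L}_!$; an $\mathcal{L}_b$-formula is (fully) conservative if it is so as an $\mathcal{L}_!$-formula), simultaneously: fully conservative $B::=p\mid1\mid\top\mid B\wedge B\mid B\vee B\mid C\to B$ ($p$ an atom, $C$ conservative); conservative $C::=\bot\mid B\mid C\wedge C\mid C\vee C\mid C*C\mid\ !C$ ($B$ fully conservative). -}

module Defs where

open import Data.Bool using (Bool; true; false)
open import Data.Nat using (ℕ; suc; _+_)
open import Data.List using (List; []; _∷_; _++_; map; length)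
open import Data.Maybe using (Maybe; just; nothing)
open import Data.Product using (_×_; _,_)
open import Data.List.Relation.Binary.Permutation.Propositional using (_↭_)

-- Formulas. Fm false = L_b, Fm true = L_! (the ! constructor only exists at index true).
-- Atoms are indexed by ℕ.
infixr 30 _⊗_
infixr 25 _∧'_ _∨'_
infixr 20 _⊸_
infix 35 !_

data Fm : Bool → Set where
  atom : ∀ {b} → ℕ → Fm b
  𝟙 𝟘 ⊤' ⊥' : ∀ {b} → Fm b
  _∧'_ _∨'_ _⊗_ _⊸_ : ∀ {b} → Fm b → Fm b → Fm b
  !_ : Fm true → Fm true

size : ∀ {b} → Fm b → ℕ
size (atom _) = 1
size 𝟙 = 1
size 𝟘 = 1
size ⊤' = 1
size ⊥' = 1
size (A ∧' B) = suc (size A + size B)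
size (A ∨' B) = suc (size A + size B)
size (A ⊗ B) = suc (size A + size B)
size (A ⊸ B) = suc (size A + size B)
size (! A) = suc (size A)

-- Der false = IMALL (over L_b), Der true = ILL (over L_!).
-- Antecedents are lists read as multisets (explicit exchange rule `ex`);
-- the succedent has at most one formula (Maybe).
infix 4 Der

data Der : (b : Bool) → List (Fm b) → Maybe (Fm b) → Set where
  ex   : ∀ {b Γ Γ' Δ} → Γ ↭ Γ' → Der b Γ Δ → Der b Γ' Δ
  ax   : ∀ {b} A → Der b (A ∷ []) (just A)
  1R   : ∀ {b} → Der b [] (just 𝟙)
  0L   : ∀ {b} → Der b (𝟘 ∷ []) nothing
  ⊤R   : ∀ {b Γ} → Der b Γ (just ⊤')
  ⊥L   : ∀ {b Γ Δ} → Der b (⊥' ∷ Γ) Δ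
  1L   : ∀ {b Γ Δ} → Der b Γ Δ → Der b (𝟙 ∷ Γ) Δ
  0R   : ∀ {b Γ} → Der b Γ nothing → Der b Γ (just 𝟘)
  ∧L₀  : ∀ {b Γ Δ A B} → Der b (A ∷ Γ) Δ → Der b (A ∧' B ∷ Γ) Δ
  ∧L₁  : ∀ {b Γ Δ A B} → Der b (B ∷ Γ) Δ → Der b (A ∧' B ∷ Γ) Δ
  ∧R   : ∀ {b Γ A B} → Der b Γ (just A) → Der b Γ (just B) → Der b Γ (just (A ∧' B))
  ∨L   : ∀ {b Γ Δ A B} → Der b (A ∷ Γ) Δ → Der b (B ∷ Γ) Δ → Der b (A ∨' B ∷ Γ) Δ
  ∨R₀  : ∀ {b Γ A B} → Der b Γ (just A) → Der b Γ (just (A ∨' B))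
  ∨R₁  : ∀ {b Γ A B} → Der b Γ (just B) → Der b Γ (just (A ∨' B))
  ⊗L   : ∀ {b Γ Δ A B} → Der b (A ∷ B ∷ Γ) Δ → Der b (A ⊗ B ∷ Γ) Δ
  ⊗R   : ∀ {b Γ Σ A B} → Der b Γ (just A) → Der b Σ (just B) → Der b (Γ ++ Σ) (just (A ⊗ B))
  ⊸L   : ∀ {b Γ Σ Λ A B} → Der b Γ (just A) → Der b (B ∷ Σ) Λ → Der b (A ⊸ B ∷ Γ ++ Σ) Λ
  ⊸R   : ∀ {b Γ A B} → Der b (A ∷ Γ) (just B) → Der b Γ (just (A ⊸ B))
  cut  : ∀ {b Γ Σ Λ A} → Der b Γ (just A) → Der b (A ∷ Σ) Λ → Der b (Γ ++ Σ) Λ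
  !R   : ∀ {Γ A} → Der true (map !_ Γ) (just A) → Der true (map !_ Γ) (just (! A))
  !D   : ∀ {Γ Δ A} → Der true (A ∷ Γ) Δ → Der true (! A ∷ Γ) Δ
  !W   : ∀ {Γ Δ A} → Der true Γ Δ → Der true (! A ∷ Γ) Δ
  !C   : ∀ {Γ Δ A} → Der true (! A ∷ ! A ∷ Γ) Δ → Der true (! A ∷ Γ) Δ

seqSize : ∀ {b} → List (Fm b) → Maybe (Fm b) → ℕ
seqSize Γ (just _) = suc (length Γ)
seqSize Γ nothing = length Γ

-- l(π): total number of formula occurrences in the sequents of π.
-- An exchange step does not change the (multiset) sequent, so it adds nothing.
len : ∀ {b Γ Δ} → Der b Γ Δ → ℕ
len (ex _ d) = len d
len {b} {Γ} {Δ} (ax _) = seqSize Γ Δ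
len {b} {Γ} {Δ} 1R = seqSize Γ Δ
len {b} {Γ} {Δ} 0L = seqSize Γ Δ
len {b} {Γ} {Δ} ⊤R = seqSize Γ Δ
len {b} {Γ} {Δ} ⊥L = seqSize Γ Δ
len {b} {Γ} {Δ} (1L d) = seqSize Γ Δ + len d
len {b} {Γ} {Δ} (0R d) = seqSize Γ Δ + len d
len {b} {Γ} {Δ} (∧L₀ d) = seqSize Γ Δ + len d
len {b} {Γ} {Δ} (∧L₁ d) = seqSize Γ Δ + len d
len {b} {Γ} {Δ} (∧R d e) = seqSize Γ Δ + len d + len e
len {b} {Γ} {Δ} (∨L d e) = seqSize Γ Δ + len d + len e
len {b} {Γ} {Δ} (∨R₀ d) = seqSize Γ Δ + len d
len {b} {Γ} {Δ} (∨R₁ d) = seqSize Γ Δ + len d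
len {b} {Γ} {Δ} (⊗L d) = seqSize Γ Δ + len d
len {b} {Γ} {Δ} (⊗R d e) = seqSize Γ Δ + len d + len e
len {b} {Γ} {Δ} (⊸L d e) = seqSize Γ Δ + len d + len e
len {b} {Γ} {Δ} (⊸R d) = seqSize Γ Δ + len d
len {b} {Γ} {Δ} (cut d e) = seqSize Γ Δ + len d + len e
len {b} {Γ} {Δ} (!R d) = seqSize Γ Δ + len d
len {b} {Γ} {Δ} (!D d) = seqSize Γ Δ + len d
len {b} {Γ} {Δ} (!W d) = seqSize Γ Δ + len d
len {b} {Γ} {Δ} (!C d) = seqSize Γ Δ + len d

_⊢_⇔_ : (b : Bool) → Fm b → Fm b → Set
b ⊢ X ⇔ Y = Der b (X ∷ []) (just Y) × Der b (Y ∷ []) (just X)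

lenIff : ∀ {b X Y} → b ⊢ X ⇔ Y → ℕ
lenIff (p , q) = len p + len q

-- Chu's translation with parameters D = N = ⊥ fixed.
mutual
  tr : ∀ {b} → Fm b → Fm b
  tr (atom p) = atom p
  tr 𝟙 = 𝟙
  tr 𝟘 = ⊥'
  tr ⊤' = ⊤'
  tr ⊥' = ⊥'
  tr (A ∧' B) = tr A ∧' tr B
  tr (A ∨' B) = tr A ∨' tr B
  tr (A ⊗ B) = tr A ⊗ tr B
  tr (A ⊸ B) = (tr A ⊸ tr B) ∧' (sr B ⊸ sr A)
  tr (! A) = ! tr A

  sr : ∀ {b} → Fm b → Fm b
  sr (atom p) = ⊥'
  sr 𝟙 = ⊥'
  sr 𝟘 = 𝟙
  sr ⊤' = ⊥'
  sr ⊥' = ⊤'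
  sr (A ∧' B) = sr A ∨' sr B
  sr (A ∨' B) = sr A ∧' sr B
  sr (A ⊗ B) = (tr A ⊸ sr B) ∧' (tr B ⊸ sr A)
  sr (A ⊸ B) = tr A ⊗ sr B
  sr (! A) = ! tr A ⊸ ⊥'

mutual
  data FullyCons {b} : Fm b → Set where
    fc-atom : ∀ p → FullyCons (atom p)
    fc-1 : FullyCons 𝟙
    fc-⊤ : FullyCons ⊤'
    fc-∧ : ∀ {A B} → FullyCons A → FullyCons B → FullyCons (A ∧' B)
    fc-∨ : ∀ {A B} → FullyCons A → FullyCons B → FullyCons (A ∨' B)
    fc-⊸ : ∀ {C B} → Cons C → FullyCons B → FullyCons (C ⊸ B)

  data Cons : ∀ {b} → Fm b → Set where
    c-⊥ : ∀ {b} → Cons {b} ⊥'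
    c-fc : ∀ {b} {B : Fm b} → FullyCons B → Cons B
    c-∧ : ∀ {b} {A B : Fm b} → Cons A → Cons B → Cons (A ∧' B)
    c-∨ : ∀ {b} {A B : Fm b} → Cons A → Cons B → Cons (A ∨' B)
    c-⊗ : ∀ {b} {A B : Fm b} → Cons A → Cons B → Cons (A ⊗ B)
    c-! : ∀ {C : Fm true} → Cons C → Cons (! C)

{-# OPTIONS --safe #-}
module Submission where

-- Each of tr B ⇔ B and sr B ⇒ ⊥' (the converse is ⊥L) is one cut away from a closed proof of
-- Cert R B = 𝟙 ∧' ((B ⊸ tr B) ∧' ((tr B ⊸ B) ∧' R)), where R = sr B ⊸ ⊥' for fully conservative B
-- and R is arbitrary for conservative B (so fully conservative subformulas come for free).
-- These closed proofs are built by induction: for every connective a fixed derivation of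
-- Cert _ (A ∘ B) from Cert _ A and Cert _ B is cut against the two proofs. The prefix 𝟙 ∧' makes a
-- certificate discardable on the left, so all additive branches of the fixed derivation share one
-- cut-in copy of each certificate; each connective thus adds a constant number of formula
-- occurrences.

open import Defs
open import Data.Bool using (Bool; true; T)
open import Data.Nat using (ℕ; suc; _+_; _*_; _≤_; _<_; _≤ᵇ_; s≤s; z≤n)
open import Data.Nat.Properties
  using (≤ᵇ⇒≤; ≤-trans; ≤-reflexive; m≤m*n; +-mono-≤; +-monoˡ-≤; *-monoʳ-≤; *-suc; *-distribˡ-+; module ≤-Reasoning)
open import Data.Nat.Tactic.RingSolver using (solve-∀)
open import Data.List using ([]; _∷_; _++_; [_])
open import Data.Maybe using (just)
open import Data.Product using (Σ; ∃; _×_; _,_; proj₂)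
open import Relation.Binary.PropositionalEquality using (_≡_; sym; cong)
open import Data.List.Relation.Binary.Permutation.Propositional using (↭-sym; swap; prep; refl)
open import Data.List.Relation.Binary.Permutation.Propositional.Properties using (shift)

module _ {b : Bool} where

  exchange : ∀ {A B : Fm b} {Γ Δ} → Der b (A ∷ B ∷ Γ) Δ → Der b (B ∷ A ∷ Γ) Δ
  exchange = ex (swap _ _ refl)

  weaken : ∀ Γ {Σ Δ} {X : Fm b} → Der b (Γ ++ Σ) Δ → Der b (Γ ++ 𝟙 ∧' X ∷ Σ) Δ
  weaken Γ d = ex (↭-sym (shift _ Γ _)) (∧L₀ (1L d))

  Cert : Fm b → Fm b → Fm b
  Cert R B = 𝟙 ∧' ((B ⊸ tr B) ∧' ((tr B ⊸ B) ∧' R))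

  FullCert : Fm b → Fm b
  FullCert B = Cert (sr B ⊸ ⊥') B

  cert-intro : ∀ {Γ} {R B : Fm b} → Der b Γ (just 𝟙) → Der b (B ∷ Γ) (just (tr B))
             → Der b (tr B ∷ Γ) (just B) → Der b Γ (just R) → Der b Γ (just (Cert R B))
  cert-intro u t f r = ∧R u (∧R (⊸R t) (∧R (⊸R f) r))

  cert-to-tr : ∀ {R B : Fm b} → Der b (B ∷ Cert R B ∷ []) (just (tr B))
  cert-to-tr = exchange (∧L₁ (∧L₀ (⊸L (ax _) (ax _))))

  cert-from-tr : ∀ {R B : Fm b} → Der b (tr B ∷ Cert R B ∷ []) (just B)
  cert-from-tr = exchange (∧L₁ (∧L₁ (∧L₀ (⊸L (ax _) (ax _)))))

  fullCert-refutes-sr : ∀ {B : Fm b} Γ {Σ Δ} → Der b (sr B ∷ Γ ++ FullCert B ∷ Σ) Δ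
  fullCert-refutes-sr {B} Γ = ex (↭-sym (shift _ (sr B ∷ Γ) _)) (∧L₁ (∧L₁ (∧L₁ (⊸L (ax _) ⊥L))))

  ∧-map : ∀ {A A' B B' X Y : Fm b} → Der b (A ∷ 𝟙 ∧' X ∷ []) (just A') → Der b (B ∷ 𝟙 ∧' Y ∷ []) (just B')
        → Der b (A ∧' B ∷ 𝟙 ∧' X ∷ 𝟙 ∧' Y ∷ []) (just (A' ∧' B'))
  ∧-map d e = ∧R (∧L₀ (weaken (_ ∷ _ ∷ []) d)) (∧L₁ (weaken [ _ ] e))

  ∨-map : ∀ {A A' B B' X Y : Fm b} → Der b (A ∷ 𝟙 ∧' X ∷ []) (just A') → Der b (B ∷ 𝟙 ∧' Y ∷ []) (just B')
        → Der b (A ∨' B ∷ 𝟙 ∧' X ∷ 𝟙 ∧' Y ∷ []) (just (A' ∨' B'))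
  ∨-map d e = ∨L (∨R₀ (weaken (_ ∷ _ ∷ []) d)) (∨R₁ (weaken [ _ ] e))

  ⊗-map : ∀ {A A' B B' X Y : Fm b} → Der b (A ∷ X ∷ []) (just A') → Der b (B ∷ Y ∷ []) (just B')
        → Der b (A ⊗ B ∷ X ∷ Y ∷ []) (just (A' ⊗ B'))
  ⊗-map d e = ⊗L (ex (prep _ (swap _ _ refl)) (⊗R d e))

  ⊸-map : ∀ {A A' B B' X Y : Fm b} → Der b (A' ∷ X ∷ []) (just A) → Der b (B ∷ Y ∷ []) (just B')
        → Der b (A ⊸ B ∷ X ∷ Y ∷ []) (just (A' ⊸ B'))
  ⊸-map d e = ⊸R (exchange (⊸L d e))

  discard-both : ∀ {X Y : Fm b} → Der b (𝟙 ∧' X ∷ 𝟙 ∧' Y ∷ []) (just 𝟙)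
  discard-both = weaken [] (weaken [] 1R)

  -- This is FullCert B whenever tr B = B and sr B = ⊥', i.e. for atoms, 𝟙 and ⊤'.
  idCert : (B : Fm b) → Der b [] (just (𝟙 ∧' ((B ⊸ B) ∧' ((B ⊸ B) ∧' (⊥' ⊸ ⊥')))))
  idCert B = ∧R 1R (∧R (⊸R (ax B)) (∧R (⊸R (ax B)) (⊸R (ax ⊥'))))

  cert-⊥ : Der b [] (just (Cert ⊤' ⊥'))
  cert-⊥ = cert-intro 1R (ax ⊥') (ax ⊥') ⊤R

  cert-∧ : ∀ {R S T A B : Fm b} → Der b (Cert R A ∷ Cert S B ∷ []) (just T)
         → Der b (Cert R A ∷ Cert S B ∷ []) (just (Cert T (A ∧' B)))
  cert-∧ = cert-intro discard-both (∧-map cert-to-tr cert-to-tr) (∧-map cert-from-tr cert-from-tr)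

  cert-∨ : ∀ {R S T A B : Fm b} → Der b (Cert R A ∷ Cert S B ∷ []) (just T)
         → Der b (Cert R A ∷ Cert S B ∷ []) (just (Cert T (A ∨' B)))
  cert-∨ = cert-intro discard-both (∨-map cert-to-tr cert-to-tr) (∨-map cert-from-tr cert-from-tr)

  cert-⊗ : ∀ {R S A B : Fm b} → Der b (Cert R A ∷ Cert S B ∷ []) (just (Cert ⊤' (A ⊗ B)))
  cert-⊗ = cert-intro discard-both (⊗-map cert-to-tr cert-to-tr) (⊗-map cert-from-tr cert-from-tr) ⊤R

  fullCert-∧ : ∀ {A B : Fm b} → Der b (FullCert A ∷ FullCert B ∷ []) (just (FullCert (A ∧' B)))
  fullCert-∧ = cert-∧ (⊸R (∨L (fullCert-refutes-sr []) (fullCert-refutes-sr [ _ ])))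

  fullCert-∨ : ∀ {A B : Fm b} → Der b (FullCert A ∷ FullCert B ∷ []) (just (FullCert (A ∨' B)))
  fullCert-∨ = cert-∨ (⊸R (∧L₀ (fullCert-refutes-sr [])))

  fullCert-⊸ : ∀ {R C B : Fm b} → Der b (Cert R C ∷ FullCert B ∷ []) (just (FullCert (C ⊸ B)))
  fullCert-⊸ = cert-intro discard-both
    (∧R (⊸-map cert-from-tr cert-to-tr) (⊸R (fullCert-refutes-sr (_ ∷ _ ∷ []))))
    (∧L₀ (⊸-map cert-to-tr cert-from-tr))
    (⊸R (⊗L (exchange (fullCert-refutes-sr (_ ∷ _ ∷ [])))))

!-map : ∀ {A A' X : Fm true} → Der true (A ∷ X ∷ []) (just A') → Der true (! A ∷ ! X ∷ []) (just (! A'))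
!-map {A} {X = X} d = !R {Γ = A ∷ X ∷ []} (!D (exchange (!D (exchange d))))

cert-! : ∀ {R C : Fm true} → Der true (! Cert R C ∷ []) (just (Cert ⊤' (! C)))
cert-! = cert-intro (!W 1R) (!-map cert-to-tr) (!-map cert-from-tr) ⊤R

+-≤-*-suc : ∀ {a x k m} → a ≤ k → x ≤ k * m → a + x ≤ k * suc m
+-≤-*-suc {k = k} {m} ha hx = ≤-trans (+-mono-≤ ha hx) (≤-reflexive (sym (*-suc k m)))

+-≤-4* : ∀ {a c k n} → 0 < n → a ≤ k * suc n → c ≤ k * suc n → a + c ≤ 4 * k * n
+-≤-4* {a} {c} {k} {n} n>0 ha hc = begin
  a + c                      ≤⟨ +-mono-≤ ha hc ⟩
  k * suc n + k * suc n      ≤⟨ +-mono-≤ (*-monoʳ-≤ k suc-n≤n+n) (*-monoʳ-≤ k suc-n≤n+n) ⟩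
  k * (n + n) + k * (n + n)  ≡⟨ regroup k n ⟩
  4 * k * n                  ∎
  where
  open ≤-Reasoning
  suc-n≤n+n : suc n ≤ n + n
  suc-n≤n+n = +-monoˡ-≤ n n>0
  regroup : ∀ k n → k * (n + n) + k * (n + n) ≡ 4 * k * n
  regroup = solve-∀

-- The largest fixed derivation, fullCert-∧, has 189 formula occurrences. Opacity keeps budget * n
-- from unfolding to n + 199 * n, which would block unification with the bounds below.
opaque
  budget : ℕ
  budget = 200

  within-budget : ∀ {n} → T (n ≤ᵇ 200) → n ≤ budget
  within-budget = ≤ᵇ⇒≤ _ _

module _ {b : Bool} where

  ProofWithin : ℕ → Fm b → Set
  ProofWithin n A = Σ (Der b [] (just A)) λ d → len d ≤ budget * n

  within-1 : ∀ {A : Fm b} (d : Der b [] (just A)) → len d ≤ budget → ProofWithin 1 A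
  within-1 d h = d , ≤-trans h (m≤m*n budget 1)

  cut₂-within : ∀ {P Q R : Fm b} {m n} (z : Der b (P ∷ Q ∷ []) (just R)) → len z + 3 ≤ budget
              → ProofWithin m P → ProofWithin n Q → ProofWithin (suc (m + n)) R
  cut₂-within {m = m} {n} z hz (x , hx) (y , hy) = cut y (cut x z) , (begin
    len (cut y (cut x z))               ≡⟨ rearrange (len x) (len y) (len z) ⟩
    (len z + 3) + (len x + len y)       ≤⟨ +-mono-≤ hz (+-mono-≤ hx hy) ⟩
    budget + (budget * m + budget * n)  ≡⟨ cong (budget +_) (sym (*-distribˡ-+ budget m n)) ⟩
    budget + budget * (m + n)           ≡⟨ sym (*-suc budget (m + n)) ⟩
    budget * suc (m + n)                ∎)
    where
    open ≤-Reasoning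
    rearrange : ∀ p q r → 1 + q + (2 + p + r) ≡ (r + 3) + (p + q)
    rearrange = solve-∀

  cut-within : ∀ {A : Fm b} {Γ Δ n} (e : Der b (A ∷ Γ) Δ) → seqSize Γ Δ + len e ≤ budget
             → ((d , _) : ProofWithin n A) → len (cut d e) ≤ budget * suc n
  cut-within {Γ = Γ} {Δ} e he (d , hd) =
    ≤-trans (≤-reflexive (rearrange (seqSize Γ Δ) (len e) (len d))) (+-≤-*-suc he hd)
    where
    rearrange : ∀ p q r → p + r + q ≡ (p + q) + r
    rearrange = solve-∀

cut!-within : ∀ {P R : Fm true} {m} (z : Der true (! P ∷ []) (just R)) → len z + 2 ≤ budget
            → ProofWithin m P → ProofWithin (suc m) R
cut!-within z hz (x , hx) = cut (!R {Γ = []} x) z ,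
  ≤-trans (≤-reflexive (rearrange (len x) (len z))) (+-≤-*-suc hz hx)
  where
  rearrange : ∀ a c → 1 + (1 + a) + c ≡ (c + 2) + a
  rearrange = solve-∀

mutual
  fullCert : ∀ {b} {B : Fm b} → FullyCons B → ProofWithin (size B) (FullCert B)
  fullCert (fc-atom p) = within-1 (idCert (atom p)) (within-budget _)
  fullCert fc-1        = within-1 (idCert 𝟙) (within-budget _)
  fullCert fc-⊤        = within-1 (idCert ⊤') (within-budget _)
  fullCert (fc-∧ f g)  = cut₂-within fullCert-∧ (within-budget _) (fullCert f) (fullCert g)
  fullCert (fc-∨ f g)  = cut₂-within fullCert-∨ (within-budget _) (fullCert f) (fullCert g)
  fullCert (fc-⊸ c f)  = cut₂-within fullCert-⊸ (within-budget _) (proj₂ (cert c)) (fullCert f)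

  cert : ∀ {b} {C : Fm b} → Cons C → ∃ λ R → ProofWithin (size C) (Cert R C)
  cert c-⊥       = ⊤' , within-1 cert-⊥ (within-budget _)
  cert (c-fc f)  = _ , fullCert f
  cert (c-∧ c d) = ⊤' , cut₂-within (cert-∧ ⊤R) (within-budget _) (proj₂ (cert c)) (proj₂ (cert d))
  cert (c-∨ c d) = ⊤' , cut₂-within (cert-∨ ⊤R) (within-budget _) (proj₂ (cert c)) (proj₂ (cert d))
  cert (c-⊗ c d) = ⊤' , cut₂-within cert-⊗ (within-budget _) (proj₂ (cert c)) (proj₂ (cert d))
  cert (c-! c)   = ⊤' , cut!-within cert-! (within-budget _) (proj₂ (cert c))

module _ {b : Bool} where

  0<size : (B : Fm b) → 0 < size B
  0<size (atom _) = s≤s z≤n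
  0<size 𝟙        = s≤s z≤n
  0<size 𝟘        = s≤s z≤n
  0<size ⊤'       = s≤s z≤n
  0<size ⊥'       = s≤s z≤n
  0<size (_ ∧' _) = s≤s z≤n
  0<size (_ ∨' _) = s≤s z≤n
  0<size (_ ⊗ _)  = s≤s z≤n
  0<size (_ ⊸ _)  = s≤s z≤n
  0<size (! _)    = s≤s z≤n

  cert⇒tr⇔ : ∀ {R B : Fm b} {n} → 0 < n → ProofWithin n (Cert R B)
           → Σ (b ⊢ tr B ⇔ B) λ π → lenIff π ≤ 4 * budget * n
  cert⇒tr⇔ {R} {B} n>0 x@(d , _) =
    (cut d from , cut d to) ,
    +-≤-4* {k = budget} n>0 (cut-within from (within-budget _) x) (cut-within to (within-budget _) x)
    where
    from : Der b (Cert R B ∷ tr B ∷ []) (just B)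
    from = exchange cert-from-tr
    to : Der b (Cert R B ∷ B ∷ []) (just (tr B))
    to = exchange cert-to-tr

  fullCert⇒sr⇔⊥ : ∀ {B : Fm b} {n} → 0 < n → ProofWithin n (FullCert B)
                → Σ (b ⊢ sr B ⇔ ⊥') λ σ → lenIff σ ≤ 4 * budget * n
  fullCert⇒sr⇔⊥ {B} {n} n>0 x@(d , _) =
    (cut d refute , ⊥L) ,
    +-≤-4* {k = budget} n>0 (cut-within refute (within-budget _) x) (≤-trans (within-budget _) (m≤m*n budget (suc n)))
    where
    refute : Der b (FullCert B ∷ sr B ∷ []) (just ⊥')
    refute = exchange (fullCert-refutes-sr [])

lemma17 : (b : Bool) → Σ ℕ λ c →
    ((B : Fm b) → FullyCons B →
       (Σ (b ⊢ tr B ⇔ B) λ π → lenIff π ≤ c * size B)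
     × (Σ (b ⊢ sr B ⇔ ⊥') λ σ → lenIff σ ≤ c * size B))
    × ((C : Fm b) → Cons C →
       Σ (b ⊢ tr C ⇔ C) λ τ → lenIff τ ≤ c * size C)
lemma17 b = 4 * budget ,
  (λ B f → cert⇒tr⇔ (0<size B) (fullCert f) , fullCert⇒sr⇔⊥ (0<size B) (fullCert f)) ,
  (λ C c → cert⇒tr⇔ (0<size C) (proj₂ (cert c)))
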